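{- Let $G=(V,E)$ be a connected graph with a fixed spanning tree $T$, let $\alpha,\beta$ be two proper 3-colourings of $G$ and let $u^*$ be a focal vertex of $\beta$. Suppose that $u^*$ is not fixed with respect to $\beta$, and let $k\in C_{\alpha,\beta}$. Then $J(k)\ge\min\{J(k_1),J(k_2)\}$.
   Context: A proper 3-colouring is a map $c:V\to\{1,2,3\}$ with $c(x)\ne c(y)$ for all $xy\in E$. $R_3(G)$ is the graph on proper 3-colourings, adjacent iff they differ on exactly one vertex. A vertex $v$ is fixed with respect to $c$ if every proper 3-colouring in the same component of $R_3(G)$ as $c$ gives $v$ the colour $c(v)$. For an edge oriented from $x$ to $y$, $w(c,\overrightarrow{xy})\in\{ -1,1\}$ satisfies $w(c,\overrightarrow{xy})\equiv c(y)-c(x)\pmod 3$; path weights are sums of edge weights; $\overrightarrow{P_{uv}}$ is the $u$–$v$ path in $T$ oriented from $u$ to $v$; $h_{\alpha,u}(c,v)=w(c,\overrightarrow{P_{uv}})-w(\alpha,\overrightarrow{P_{uv}})$. A focal vertex $u^*$ of $\beta$ is: an arbitrary fixed vertex with respect to $\beta$ if one exists; otherwise a vertex which is a median when the vertices are ordered by $h_{\alpha,u}(\beta,v)$ for some vertex $u$ (this order does not depend on $u$), i.e. at least $n/2$ vertices $v$ have $h_{\alpha,u}(\beta,v)\le h_{\alpha,u}(\beta,u^*)$ and at least $n/2$ have $h_{\alpha,u}(\beta,v)\ge h_{\alpha,u}(\beta,u^*)$, where $n=|V|$. Define $J(k)=\sum_{v\in V}|k+h_{\alpha,u^*}(\beta,v)|$.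 $C_{\alpha,\beta}$ is the set of integers congruent to $2(\alpha(u^*)-\beta(u^*))$ modulo 6, and $k_1$ (resp. $k_2$) is the smallest non-negative (resp. largest non-positive) integer in $C_{\alpha,\beta}$. -}

module Defs where

open import Data.Nat using (ℕ; zero; suc; _≤_) renaming (_*_ to _*ℕ_; _⊓_ to _⊓ℕ_)
open import Data.Fin using (Fin; toℕ) renaming (zero to f0; suc to fs)
open import Data.Integer using (ℤ; +_; -_; _+_; _-_; _*_; ∣_∣; _≤?_) renaming (_≤_ to _≤ℤ_)
open import Data.Integer.Divisibility using (_∣_)
open import Data.List using (List; []; _∷_; filter; allFin; map; length)
open import Data.Nat.ListAction using (sum)
open import Data.List.Relation.Unary.Unique.Propositional using (Unique)
open import Data.Product using (Σ; _×_; _,_; ∃)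
open import Data.Sum using (_⊎_)
open import Relation.Nullary using (¬_)
open import Relation.Binary.PropositionalEquality using (_≡_; _≢_)
open import Relation.Binary.Construct.Closure.ReflexiveTransitive using (Star)

record Graph (n : ℕ) : Set₁ where
  field
    E      : Fin n → Fin n → Set
    sym    : ∀ {x y} → E x y → E y x
    irrefl : ∀ {x} → ¬ E x x
open Graph public

data Walk {n : ℕ} (R : Fin n → Fin n → Set) : Fin n → Fin n → Set where
  []  : ∀ {x} → Walk R x x
  _∷_ : ∀ {x y z} → R x y → Walk R y z → Walk R x z

module _ {n : ℕ} {R : Fin n → Fin n → Set} where
  verts : ∀ {x y} → Walk R x y → List (Fin n)
  verts {x} []      = x ∷ []
  verts {x} (e ∷ p) = x ∷ verts p

  len : ∀ {x y} → Walk R x y → ℕ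
  len []      = 0
  len (e ∷ p) = suc (len p)

  Simple : ∀ {x y} → Walk R x y → Set
  Simple p = Unique (verts p)

Connected : ∀ {n} → (Fin n → Fin n → Set) → Set
Connected R = ∀ x y → Walk R x y

-- no cycle: a cycle is an edge x–y together with a path y … x of length ≥ 2
Acyclic : ∀ {n} → (Fin n → Fin n → Set) → Set
Acyclic R = ¬ (Σ _ λ x → Σ _ λ y → R x y × Σ (Walk R y x) λ p → Simple p × 2 ≤ len p)

record IsSpanningTree {n} (G : Graph n) (T : Fin n → Fin n → Set) : Set where
  field
    sub       : ∀ {x y} → T x y → E G x y
    symT      : ∀ {x y} → T x y → T y x
    connected : Connected T
    acyclic   : Acyclic T

-- 3-colourings; colour i : Fin 3 stands for colour i+1 ∈ {1,2,3}
Colouring : ℕ → Set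
Colouring n = Fin n → Fin 3

Proper : ∀ {n} → Graph n → Colouring n → Set
Proper G c = ∀ x y → E G x y → c x ≢ c y

DiffOne : ∀ {n} → Colouring n → Colouring n → Set
DiffOne c c' = Σ _ λ v → c v ≢ c' v × (∀ w → w ≢ v → c w ≡ c' w)

Step : ∀ {n} → Graph n → Colouring n → Colouring n → Set
Step G c c' = Proper G c × Proper G c' × DiffOne c c'

Reach : ∀ {n} → Graph n → Colouring n → Colouring n → Set
Reach G = Star (Step G)

Fixed : ∀ {n} → Graph n → Colouring n → Fin n → Set
Fixed G c v = ∀ c' → Reach G c c' → c' v ≡ c v

-- w for an edge oriented from a colour a to a colour b: the element of {-1,1}
-- congruent to b - a mod 3 (value 0 when a = b, never used on proper edges)
wcol : Fin 3 → Fin 3 → ℤ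
wcol f0 (fs f0)      = + 1
wcol (fs f0) (fs (fs f0)) = + 1
wcol (fs (fs f0)) f0 = + 1
wcol f0 (fs (fs f0)) = - (+ 1)
wcol (fs f0) f0      = - (+ 1)
wcol (fs (fs f0)) (fs f0) = - (+ 1)
wcol _ _ = + 0

wt : ∀ {n} {R : Fin n → Fin n → Set} {x y} → Colouring n → Walk R x y → ℤ
wt c [] = + 0
wt c (_∷_ {x} {y} e p) = wcol (c x) (c y) + wt c p

PathSel : ∀ {n} → (Fin n → Fin n → Set) → Set
PathSel T = ∀ u v → Walk T u v

module _ {n : ℕ} {T : Fin n → Fin n → Set} (P : PathSel T) (α : Colouring n) where
  h : Fin n → Colouring n → Fin n → ℤ
  h u c v = wt c (P u v) - wt α (P u v)

  Median : Colouring n → Fin n → Fin n → Set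
  Median β u ustar =
    (n ≤ 2 *ℕ length (filter (λ v → h u β v ≤? h u β ustar) (allFin n))) ×
    (n ≤ 2 *ℕ length (filter (λ v → h u β ustar ≤? h u β v) (allFin n)))

  J : Colouring n → Fin n → ℤ → ℕ
  J β ustar k = sum (map (λ v → ∣ k + h ustar β v ∣) (allFin n))

  InC : Colouring n → Fin n → ℤ → Set
  InC β ustar k = (+ 6) ∣ (k - (+ 2) * ((+ toℕ (α ustar)) - (+ toℕ (β ustar))))

  IsK1 : Colouring n → Fin n → ℤ → Set
  IsK1 β ustar k1 = InC β ustar k1 × (+ 0) ≤ℤ k1 ×
    (∀ k → InC β ustar k → (+ 0) ≤ℤ k → k1 ≤ℤ k)

  IsK2 : Colouring n → Fin n → ℤ → Set
  IsK2 β ustar k2 = InC β ustar k2 × k2 ≤ℤ (+ 0) ×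
    (∀ k → InC β ustar k → k ≤ℤ (+ 0) → k ≤ℤ k2)

Focal : ∀ {n} (G : Graph n) {T : Fin n → Fin n → Set} → PathSel T →
        Colouring n → Colouring n → Fin n → Set
Focal {n} G P α β ustar =
  Fixed G β ustar ⊎ ((∀ v → ¬ Fixed G β v) × Σ (Fin n) λ u → Median P α β u ustar)

-- In a tree the weight of a walk depends only on its endpoints: a closed walk either
-- revisits a vertex, so it splits into two shorter closed walks, or it is an edge
-- traversed back and forth (a longer simple return would be a cycle). Hence
-- h_{α,u}(β,v) = h_{α,u}(β,u*) + h_{α,u*}(β,v), and the median property of u* says that
-- at least half of the values g v := h_{α,u*}(β,v) are ≥ 0 and at least half are ≤ 0.
-- Then J(k) = Σ ∣k + g v∣ is non-decreasing on k ≥ 0 (raising k by one adds 1 to each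
-- term with g v ≥ 0 and removes at most 1 from each other term) and non-increasing on
-- k ≤ 0, so J(k) ≥ J(k₁) for k ≥ 0 and J(k) ≥ J(k₂) for k ≤ 0.
module Submission where

open import Defs hiding (sym)
open import Data.Nat as ℕ using (ℕ; suc; _≤_; _⊓_; z≤n; s≤s; _≤′_; ≤′-refl; ≤′-step)
import Data.Nat.Properties as ℕP
open import Data.Nat.ListAction using (sum)
import Data.Nat.Tactic.RingSolver as ℕSolver
open import Data.Fin using (Fin) renaming (zero to f0; suc to fs)
import Data.Fin.Properties as FinP
open import Data.Integer as ℤ using (ℤ; +_; -_; _+_; _-_; ∣_∣; _≤?_; +≤+) renaming (_≤_ to _≤ℤ_)
import Data.Integer.Properties as ℤP
import Data.Integer.Tactic.RingSolver as ℤSolver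
open import Data.List using (List; []; _∷_; filter; map; length; allFin)
import Data.List.Properties as ListP
open import Data.List.Membership.Propositional using (_∈_)
open import Data.List.Relation.Unary.Any using (here; there; any?)
open import Data.List.Relation.Unary.All.Properties using (¬Any⇒All¬)
import Data.List.Relation.Unary.All as All
import Data.List.Relation.Unary.AllPairs as AllPairs
open import Data.List.Relation.Binary.Sublist.Propositional using (⊆-refl)
open import Data.List.Relation.Binary.Sublist.Propositional.Properties using (filter⁺; length-mono-≤)
open import Data.Product using (Σ; _×_; _,_)
open import Data.Sum using (_⊎_; inj₁; inj₂)
open import Data.Empty using (⊥-elim)
open import Relation.Nullary using (¬_; yes; no)
open import Level using (0ℓ)
open import Relation.Unary using (Pred; Decidable)
open import Relation.Binary.PropositionalEquality
  using (_≡_; refl; sym; trans; cong; cong₂; subst; subst₂; module ≡-Reasoning)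

wcol-antisym : ∀ a b → wcol b a ≡ - wcol a b
wcol-antisym f0           f0           = refl
wcol-antisym f0           (fs f0)      = refl
wcol-antisym f0           (fs (fs f0)) = refl
wcol-antisym (fs f0)      f0           = refl
wcol-antisym (fs f0)      (fs f0)      = refl
wcol-antisym (fs f0)      (fs (fs f0)) = refl
wcol-antisym (fs (fs f0)) f0           = refl
wcol-antisym (fs (fs f0)) (fs f0)      = refl
wcol-antisym (fs (fs f0)) (fs (fs f0)) = refl

wcol-self : ∀ a → wcol a a ≡ + 0
wcol-self f0           = refl
wcol-self (fs f0)      = refl
wcol-self (fs (fs f0)) = refl

wcol-cancel : ∀ a b → wcol a b + wcol b a ≡ + 0
wcol-cancel a b = trans (cong (_+_ (wcol a b)) (wcol-antisym a b)) (ℤP.+-inverseʳ (wcol a b))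

module _ {n : ℕ} {R : Fin n → Fin n → Set} where

  infixr 5 _++ʷ_

  _++ʷ_ : ∀ {x y z} → Walk R x y → Walk R y z → Walk R x z
  []      ++ʷ q = q
  (e ∷ p) ++ʷ q = e ∷ (p ++ʷ q)

  wt-++ʷ : (c : Colouring n) → ∀ {x y z} (p : Walk R x y) (q : Walk R y z) →
           wt c (p ++ʷ q) ≡ wt c p + wt c q
  wt-++ʷ c []                q = sym (ℤP.+-identityˡ (wt c q))
  wt-++ʷ c (_∷_ {x} {y} e p) q =
    trans (cong (_+_ (wcol (c x) (c y))) (wt-++ʷ c p q))
          (sym (ℤP.+-assoc (wcol (c x) (c y)) (wt c p) (wt c q)))

  len-++ʷ : ∀ {x y z} (p : Walk R x y) (q : Walk R y z) → len (p ++ʷ q) ≡ len p ℕ.+ len q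
  len-++ʷ []      q = refl
  len-++ʷ (e ∷ p) q = cong suc (len-++ʷ p q)

  wt-excise : (c : Colouring n) → ∀ {x y z} (a : Walk R x y) (b : Walk R y y) (r : Walk R y z) →
              wt c b ≡ + 0 → wt c (a ++ʷ b ++ʷ r) ≡ wt c (a ++ʷ r)
  wt-excise c a b r b≡0 = begin
    wt c (a ++ʷ b ++ʷ r)         ≡⟨ wt-++ʷ c a (b ++ʷ r) ⟩
    wt c a + wt c (b ++ʷ r)      ≡⟨ cong (_+_ (wt c a)) (wt-++ʷ c b r) ⟩
    wt c a + (wt c b + wt c r)   ≡⟨ cong (λ t → wt c a + (t + wt c r)) b≡0 ⟩
    wt c a + (+ 0 + wt c r)      ≡⟨ cong (_+_ (wt c a)) (ℤP.+-identityˡ (wt c r)) ⟩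
    wt c a + wt c r              ≡⟨ sym (wt-++ʷ c a r) ⟩
    wt c (a ++ʷ r)               ∎
    where open ≡-Reasoning

  len-excise : ∀ {x y z} (a : Walk R x y) (b : Walk R y y) (r : Walk R y z) →
               len (a ++ʷ b ++ʷ r) ≡ len b ℕ.+ len (a ++ʷ r)
  len-excise a b r = begin
    len (a ++ʷ b ++ʷ r)          ≡⟨ trans (len-++ʷ a (b ++ʷ r)) (cong (len a ℕ.+_) (len-++ʷ b r)) ⟩
    len a ℕ.+ (len b ℕ.+ len r)  ≡⟨ swap (len a) (len b) (len r) ⟩
    len b ℕ.+ (len a ℕ.+ len r)  ≡⟨ cong (len b ℕ.+_) (sym (len-++ʷ a r)) ⟩
    len b ℕ.+ len (a ++ʷ r)      ∎
    where
    open ≡-Reasoning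
    swap : ∀ i j k → i ℕ.+ (j ℕ.+ k) ≡ j ℕ.+ (i ℕ.+ k)
    swap = ℕSolver.solve-∀

  split-at : ∀ {x y z} (q : Walk R y x) → z ∈ verts q →
             Σ (Walk R y z) λ a → Σ (Walk R z x) λ r → q ≡ a ++ʷ r
  split-at []      (here refl) = [] , [] , refl
  split-at (e ∷ q) (here refl) = [] , e ∷ q , refl
  split-at (e ∷ q) (there z∈q) with split-at q z∈q
  ... | a , r , refl = e ∷ a , r , refl

  data Revisits : ∀ {y x} → Walk R y x → Set where
    revisit : ∀ {y z x} (a : Walk R y z) (b : Walk R z z) (r : Walk R z x) →
              1 ≤ len b → Revisits (a ++ʷ b ++ʷ r)

  simple⊎revisits : ∀ {y x} (q : Walk R y x) → Simple q ⊎ Revisits q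
  simple⊎revisits [] = inj₁ (All.[] AllPairs.∷ AllPairs.[])
  simple⊎revisits {y} (e ∷ q) with simple⊎revisits q
  ... | inj₂ (revisit a b r b≥1) = inj₂ (revisit (e ∷ a) b r b≥1)
  ... | inj₁ q-simple with any? (y FinP.≟_) (verts q)
  ...   | no y∉q  = inj₁ (¬Any⇒All¬ (verts q) y∉q AllPairs.∷ q-simple)
  ...   | yes y∈q with split-at q y∈q
  ...     | a , r , refl = inj₂ (revisit [] (e ∷ a) r (s≤s z≤n))

module _ {n : ℕ} {T : Fin n → Fin n → Set} (acyclic : Acyclic T) (c : Colouring n) where

  wt-simple-return : ∀ {x y} (e : T x y) (q : Walk T y x) → Simple q → wt c (e ∷ q) ≡ + 0
  wt-simple-return {x} e [] _ = trans (ℤP.+-identityʳ _) (wcol-self (c x))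
  wt-simple-return {x} {y} e (_ ∷ []) _ =
    trans (cong (_+_ (wcol (c x) (c y))) (ℤP.+-identityʳ _)) (wcol-cancel (c x) (c y))
  wt-simple-return {x} {y} e q@(_ ∷ _ ∷ _) q-simple =
    ⊥-elim (acyclic (x , y , e , q , q-simple , s≤s (s≤s z≤n)))

  wt-closed-bounded : ∀ m {x} (p : Walk T x x) → len p ≤ m → wt c p ≡ + 0
  wt-closed-bounded m       []      _ = refl
  wt-closed-bounded (suc m) {x} (_∷_ {y = y} e q) (s≤s q≤m) with simple⊎revisits q
  ... | inj₁ q-simple = wt-simple-return e q q-simple
  ... | inj₂ (revisit a b r b≥1) =
    trans (cong (_+_ (wcol (c x) (c y))) (wt-excise c a b r (wt-closed-bounded m b b≤m)))
          (wt-closed-bounded m (e ∷ a ++ʷ r) shortened≤m)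
    where
    pieces≤m : len b ℕ.+ len (a ++ʷ r) ≤ m
    pieces≤m = subst (_≤ m) (len-excise a b r) q≤m
    b≤m : len b ≤ m
    b≤m = ℕP.≤-trans (ℕP.m≤m+n (len b) _) pieces≤m
    shortened≤m : suc (len (a ++ʷ r)) ≤ m
    shortened≤m = ℕP.≤-trans (ℕP.+-monoˡ-≤ (len (a ++ʷ r)) b≥1) pieces≤m

  wt-closed : ∀ {x} (p : Walk T x x) → wt c p ≡ + 0
  wt-closed p = wt-closed-bounded (len p) p ℕP.≤-refl

module _ {n : ℕ} {T : Fin n → Fin n → Set} (symT : ∀ {x y} → T x y → T y x) where

  reverse : ∀ {x y} → Walk T x y → Walk T y x
  reverse []      = []
  reverse (e ∷ p) = reverse p ++ʷ (symT e ∷ [])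

  wt-reverse : (c : Colouring n) → ∀ {x y} (p : Walk T x y) → wt c (reverse p) ≡ - wt c p
  wt-reverse c []                = refl
  wt-reverse c (_∷_ {x} {y} e p) = begin
    wt c (reverse p ++ʷ (symT e ∷ []))        ≡⟨ wt-++ʷ c (reverse p) (symT e ∷ []) ⟩
    wt c (reverse p) + (wcol (c y) (c x) + + 0) ≡⟨ cong₂ _+_ (wt-reverse c p) (ℤP.+-identityʳ _) ⟩
    - wt c p + wcol (c y) (c x)               ≡⟨ cong (_+_ (- wt c p)) (wcol-antisym (c x) (c y)) ⟩
    - wt c p + - wcol (c x) (c y)             ≡⟨ sym (ℤP.neg-distrib-+ (wt c p) _) ⟩
    - (wt c p + wcol (c x) (c y))             ≡⟨ cong -_ (ℤP.+-comm (wt c p) _) ⟩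
    - (wcol (c x) (c y) + wt c p)             ∎
    where open ≡-Reasoning

  wt-unique : Acyclic T → (c : Colouring n) → ∀ {x y} (p q : Walk T x y) → wt c p ≡ wt c q
  wt-unique acyclic c p q = ℤP.i-j≡0⇒i≡j (wt c p) (wt c q) (begin
    wt c p - wt c q               ≡⟨ cong (_+_ (wt c p)) (sym (wt-reverse c q)) ⟩
    wt c p + wt c (reverse q)     ≡⟨ sym (wt-++ʷ c p (reverse q)) ⟩
    wt c (p ++ʷ reverse q)        ≡⟨ wt-closed acyclic c (p ++ʷ reverse q) ⟩
    + 0                           ∎)
    where open ≡-Reasoning

suc-increasing⇒monotone : (f : ℕ → ℕ) → (∀ m → f m ≤ f (suc m)) → ∀ {i j} → i ≤ j → f i ≤ f j
suc-increasing⇒monotone f f-suc i≤j = go (ℕP.≤⇒≤′ i≤j)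
  where
  go : ∀ {i j} → i ≤′ j → f i ≤ f j
  go ≤′-refl        = ℕP.≤-refl
  go (≤′-step i≤′j) = ℕP.≤-trans (go i≤′j) (f-suc _)

+-mono-≤-regrouped : ∀ {a b s t d p l} → 2 ℕ.* d ℕ.+ a ≤ suc b → s ℕ.+ 2 ℕ.* p ≤ t ℕ.+ l →
                     (a ℕ.+ s) ℕ.+ 2 ℕ.* (d ℕ.+ p) ≤ (b ℕ.+ t) ℕ.+ suc l
+-mono-≤-regrouped {a} {b} {s} {t} {d} {p} {l} head tail =
  subst₂ _≤_ (lhs a s d p) (rhs b t l) (ℕP.+-mono-≤ head tail)
  where
  lhs : ∀ a s d p → (2 ℕ.* d ℕ.+ a) ℕ.+ (s ℕ.+ 2 ℕ.* p) ≡ (a ℕ.+ s) ℕ.+ 2 ℕ.* (d ℕ.+ p)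
  lhs = ℕSolver.solve-∀
  rhs : ∀ b t l → suc b ℕ.+ (t ℕ.+ l) ≡ (b ℕ.+ t) ℕ.+ suc l
  rhs = ℕSolver.solve-∀

2+∣i+j∣≤1+∣1+i+j∣ : ∀ {i j} → + 0 ≤ℤ i → + 0 ≤ℤ j → 2 ℕ.+ ∣ i + j ∣ ≤ suc ∣ ℤ.suc i + j ∣
2+∣i+j∣≤1+∣1+i+j∣ (+≤+ _) (+≤+ _) = ℕP.≤-refl

∣i+j∣≤1+∣1+i+j∣ : ∀ i j → ∣ i + j ∣ ≤ suc ∣ ℤ.suc i + j ∣
∣i+j∣≤1+∣1+i+j∣ i j = begin
  ∣ i + j ∣                      ≡⟨ cong ∣_∣ (sym (ℤP.pred-suc (i + j))) ⟩
  ∣ ℤ.pred (ℤ.suc (i + j)) ∣     ≤⟨ ℤP.∣i+j∣≤∣i∣+∣j∣ (- + 1) (ℤ.suc (i + j)) ⟩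
  suc ∣ ℤ.suc (i + j) ∣          ≡⟨ cong (λ t → suc ∣ t ∣) (sym (ℤP.+-assoc (+ 1) i j)) ⟩
  suc ∣ ℤ.suc i + j ∣            ∎
  where open ℕP.≤-Reasoning

module _ {A : Set} (g : A → ℤ) where

  absSum : ℤ → List A → ℕ
  absSum k xs = sum (map (λ x → ∣ k + g x ∣) xs)

  nonnegatives : List A → ℕ
  nonnegatives xs = length (filter (λ x → + 0 ≤? g x) xs)

  absSum-suc : ∀ {k} → + 0 ≤ℤ k → ∀ xs →
               absSum k xs ℕ.+ 2 ℕ.* nonnegatives xs ≤ absSum (ℤ.suc k) xs ℕ.+ length xs
  absSum-suc k≥0 [] = z≤n
  absSum-suc {k} k≥0 (x ∷ xs) with + 0 ≤? g x
  ... | yes gx≥0 = +-mono-≤-regrouped {d = 1} {p = nonnegatives xs}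
                     (2+∣i+j∣≤1+∣1+i+j∣ k≥0 gx≥0) (absSum-suc k≥0 xs)
  ... | no _     = +-mono-≤-regrouped {d = 0} {p = nonnegatives xs}
                     (∣i+j∣≤1+∣1+i+j∣ k (g x)) (absSum-suc k≥0 xs)

  absSum-suc-mono : ∀ xs → length xs ≤ 2 ℕ.* nonnegatives xs →
                    ∀ {k} → + 0 ≤ℤ k → absSum k xs ≤ absSum (ℤ.suc k) xs
  absSum-suc-mono xs half {k} k≥0 = ℕP.+-cancelʳ-≤ (2 ℕ.* nonnegatives xs) _ _ (begin
    absSum k xs ℕ.+ 2 ℕ.* nonnegatives xs         ≤⟨ absSum-suc k≥0 xs ⟩
    absSum (ℤ.suc k) xs ℕ.+ length xs             ≤⟨ ℕP.+-monoʳ-≤ (absSum (ℤ.suc k) xs) half ⟩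
    absSum (ℤ.suc k) xs ℕ.+ 2 ℕ.* nonnegatives xs ∎)
    where open ℕP.≤-Reasoning

  absSum-monotone : ∀ xs → length xs ≤ 2 ℕ.* nonnegatives xs →
                    ∀ {i j} → + 0 ≤ℤ i → i ≤ℤ j → absSum i xs ≤ absSum j xs
  absSum-monotone xs half (+≤+ _) (+≤+ m≤n) =
    suc-increasing⇒monotone (λ m → absSum (+ m) xs) (λ m → absSum-suc-mono xs half (+≤+ z≤n)) m≤n

absSum-neg : ∀ {A : Set} (g : A → ℤ) k xs → absSum g k xs ≡ absSum (λ x → - g x) (- k) xs
absSum-neg g k xs = cong sum (ListP.map-cong ∣k+g∣≡∣-k-g∣ xs)
  where
  ∣k+g∣≡∣-k-g∣ : ∀ x → ∣ k + g x ∣ ≡ ∣ - k + - g x ∣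
  ∣k+g∣≡∣-k-g∣ x = trans (sym (ℤP.∣-i∣≡∣i∣ (k + g x))) (cong ∣_∣ (ℤP.neg-distrib-+ k (g x)))

absSum-antitone : ∀ {A : Set} (g : A → ℤ) xs → length xs ≤ 2 ℕ.* nonnegatives (λ x → - g x) xs →
                  ∀ {i j} → i ≤ℤ j → j ≤ℤ + 0 → absSum g j xs ≤ absSum g i xs
absSum-antitone g xs half {i} {j} i≤j j≤0 =
  subst₂ _≤_ (sym (absSum-neg g j xs)) (sym (absSum-neg g i xs))
    (absSum-monotone (λ x → - g x) xs half (ℤP.neg-mono-≤ j≤0) (ℤP.neg-mono-≤ i≤j))

≤+⇒0≤ : ∀ i j → i ≤ℤ i + j → + 0 ≤ℤ j
≤+⇒0≤ i j i≤i+j = subst (+ 0 ≤ℤ_) (cancel i j) (ℤP.i≤j⇒0≤j-i i≤i+j)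
  where
  cancel : ∀ i j → (i + j) - i ≡ j
  cancel = ℤSolver.solve-∀

+≤⇒0≤- : ∀ i j → i + j ≤ℤ i → + 0 ≤ℤ - j
+≤⇒0≤- i j i+j≤i = subst (+ 0 ≤ℤ_) (cancel i j) (ℤP.i≤j⇒0≤j-i i+j≤i)
  where
  cancel : ∀ i j → i - (i + j) ≡ - j
  cancel = ℤSolver.solve-∀

length-filter-mono : ∀ {A : Set} {P Q : Pred A 0ℓ} (P? : Decidable P) (Q? : Decidable Q) →
                     (∀ {x} → P x → Q x) → ∀ xs → length (filter P? xs) ≤ length (filter Q? xs)
length-filter-mono P? Q? P⇒Q xs = length-mono-≤ (filter⁺ P? Q? (λ { refl → P⇒Q }) (⊆-refl {x = xs}))

module _ {n : ℕ} {T : Fin n → Fin n → Set} (symT : ∀ {x y} → T x y → T y x) (acyclic : Acyclic T)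
         (P : PathSel T) (α : Colouring n) where

  wt-path-additive : (c : Colouring n) → ∀ u w v → wt c (P u v) ≡ wt c (P u w) + wt c (P w v)
  wt-path-additive c u w v =
    trans (wt-unique symT acyclic c (P u v) (P u w ++ʷ P w v)) (wt-++ʷ c (P u w) (P w v))

  h-recentre : (β : Colouring n) → ∀ u w v → h P α u β v ≡ h P α u β w + h P α w β v
  h-recentre β u w v = begin
    wt β (P u v) - wt α (P u v)
      ≡⟨ cong₂ _-_ (wt-path-additive β u w v) (wt-path-additive α u w v) ⟩
    (wt β (P u w) + wt β (P w v)) - (wt α (P u w) + wt α (P w v))
      ≡⟨ regroup (wt β (P u w)) (wt β (P w v)) (wt α (P u w)) (wt α (P w v)) ⟩
    (wt β (P u w) - wt α (P u w)) + (wt β (P w v) - wt α (P w v)) ∎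
    where
    open ≡-Reasoning
    regroup : ∀ b₁ b₂ a₁ a₂ → (b₁ + b₂) - (a₁ + a₂) ≡ (b₁ - a₁) + (b₂ - a₂)
    regroup = ℤSolver.solve-∀

  median-balanced : (β : Colouring n) → ∀ u ustar → Median P α β u ustar →
                    (length (allFin n) ≤ 2 ℕ.* nonnegatives (h P α ustar β) (allFin n)) ×
                    (length (allFin n) ≤ 2 ℕ.* nonnegatives (λ v → - h P α ustar β v) (allFin n))
  median-balanced β u ustar (below , above) =
    counted above (length-filter-mono _ _ above⇒nonneg (allFin n)) ,
    counted below (length-filter-mono _ _ below⇒nonpos (allFin n))
    where
    counted : ∀ {a b} → n ≤ 2 ℕ.* a → a ≤ b → length (allFin n) ≤ 2 ℕ.* b
    counted n≤2a a≤b = subst (_≤ _) (sym (ListP.length-tabulate (λ v → v)))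
                             (ℕP.≤-trans n≤2a (ℕP.*-monoʳ-≤ 2 a≤b))
    h* = h P α u β ustar
    above⇒nonneg : ∀ {v} → h* ≤ℤ h P α u β v → + 0 ≤ℤ h P α ustar β v
    above⇒nonneg {v} le = ≤+⇒0≤ h* _ (subst (h* ≤ℤ_) (h-recentre β u ustar v) le)
    below⇒nonpos : ∀ {v} → h P α u β v ≤ℤ h* → + 0 ≤ℤ - h P α ustar β v
    below⇒nonpos {v} le = +≤⇒0≤- h* _ (subst (_≤ℤ h*) (h-recentre β u ustar v) le)

lemma10 : ∀ {n : ℕ} (G : Graph n) (T : Fin n → Fin n → Set)
            → Connected (E G) → IsSpanningTree G T
            → (P : PathSel T) → (∀ u v → Simple (P u v))
            → (α β : Colouring n) → Proper G α → Proper G β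
            → (ustar : Fin n) → Focal G P α β ustar → ¬ Fixed G β ustar
            → (k k1 k2 : ℤ) → InC P α β ustar k
            → IsK1 P α β ustar k1 → IsK2 P α β ustar k2
            → J P α β ustar k1 ⊓ J P α β ustar k2 ≤ J P α β ustar k
lemma10 G T _ _ P _ α β _ _ ustar (inj₁ fixed) unfixed _ _ _ _ _ _ = ⊥-elim (unfixed fixed)
lemma10 {n} G T _ tree P _ α β _ _ ustar (inj₂ (_ , u , median)) _ k k1 k2 k∈C
        (_ , 0≤k1 , k1-least) (_ , k2≤0 , k2-greatest)
  with median-balanced (IsSpanningTree.symT tree) (IsSpanningTree.acyclic tree) P α β u ustar median
     | ℤP.≤-total (+ 0) k
... | half₊ , _ | inj₁ 0≤k =
  ℕP.≤-trans (ℕP.m⊓n≤m _ _) (absSum-monotone _ (allFin n) half₊ 0≤k1 (k1-least k k∈C 0≤k))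
... | _ , half₋ | inj₂ k≤0 =
  ℕP.≤-trans (ℕP.m⊓n≤n _ _) (absSum-antitone _ (allFin n) half₋ (k2-greatest k k∈C k≤0) k2≤0)
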